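{- Let $n=p_1^{n_1}\cdots p_r^{n_r}$ with primes $p_1<\cdots<p_r$, positive integers $n_i$, and $r\geq 3$. Let $a\in[r]$ with $n_a\geq 2$. Then: (i) if $2\phi\!\left(\frac{p_1\cdots p_r}{p_a}\right)>\frac{p_1\cdots p_r}{p_a}$, then $|Z_a^1|<|Z_a^2|<\cdots<|Z_a^{n_a}|$; (ii) if $2\phi\!\left(\frac{p_1\cdots p_r}{p_a}\right)<\frac{p_1\cdots p_r}{p_a}$, then $|Z_a^1|>|Z_a^2|>\cdots>|Z_a^{n_a}|$.
   Context: $\phi$ is Euler's totient function; $C_n$ is the cyclic group of order $n$; $[m]=\{1,\dots,m\}$. $E_d$ is the set of elements of $C_n$ of order $d$, $S_d$ the subgroup of order $d$. For $s\in[n_a]$, $Q_a^s$ is the union of the subgroups $S_{n/(p_ip_a^s)}$ over $i\in[r]\setminus\{a\}$, and $Z_a^s:=E_n\cup E_{n/p_a}\cup\cdots\cup E_{n/p_a^{s-1}}\cup Q_a^s$. -}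

module Defs where

open import Data.Bool using (Bool; true; false; if_then_else_; _∧_; _∨_; not)
open import Data.Nat using (ℕ; zero; suc; _+_; _*_; _^_; _<_; _≤_; _/_; _≡ᵇ_)
open import Data.Nat.Divisibility using (_∣?_)
open import Data.Nat.GCD using (gcd)
open import Data.Fin using (Fin; _≟_)
open import Data.List using (List; []; _∷_; upTo; map; allFin)
open import Data.Bool.ListAction using (any)
open import Data.Nat.ListAction using (product)
open import Relation.Nullary using (does)

-- Total division: m div 0 = 0, otherwise ordinary floor division.
-- (Only ever used with a nonzero divisor that divides m.)
_div_ : ℕ → ℕ → ℕ
m div zero = 0
m div suc k = m / suc k

count : {A : Set} → (A → Bool) → List A → ℕ
count f [] = 0
count f (x ∷ xs) = if f x then suc (count f xs) else count f xs

φ : ℕ → ℕ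
φ m = count (λ k → gcd k m ≡ᵇ 1) (map suc (upTo m))

-- The cyclic group C_n is modelled additively as ℤ/nℤ with
-- elements x ∈ {0,…,n-1} (the list upTo n).

first : (ℕ → Bool) → List ℕ → ℕ
first f [] = 0
first f (k ∷ ks) = if f k then k else first f ks

ord : ℕ → ℕ → ℕ
ord n x = first (λ k → does (n ∣? (k * x))) (map suc (upTo n))

inE : ℕ → ℕ → ℕ → Bool
inE n d x = ord n x ≡ᵇ d

-- x ∈ S_d : x lies in the subgroup of order d (d ∣ n), i.e. d·x = 0
inS : ℕ → ℕ → ℕ → Bool
inS n d x = does (n ∣? (d * x))

module _ (r : ℕ) (p e : Fin r → ℕ) (a : Fin r) where

  nOf : ℕ
  nOf = product (map (λ i → p i ^ e i) (allFin r))

  -- x ∈ Q_a^s = ⋃_{i ≠ a} S_{n/(p_i p_a^s)}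
  inQ : ℕ → ℕ → Bool
  inQ s x = any (λ i → not (does (i ≟ a)) ∧ inS nOf (nOf div (p i * p a ^ s)) x)
                (allFin r)

  -- x ∈ Z_a^s = E_n ∪ E_{n/p_a} ∪ ⋯ ∪ E_{n/p_a^{s-1}} ∪ Q_a^s
  inZ : ℕ → ℕ → Bool
  inZ s x = any (λ j → inE nOf (nOf div (p a ^ j)) x) (upTo s) ∨ inQ s x

  cardZ : ℕ → ℕ
  cardZ s = count (inZ s) (upTo nOf)

  radQuot : ℕ
  radQuot = product (map p (allFin r)) div p a

-- An element x of ℤ/nℤ lies in Z_a^s exactly when one, but not both, of
-- "x is coprime to R = p_1⋯p_r / p_a" and "p_a^s divides x" holds: the elements of order
-- n/p_a^j (j < s) are those x with gcd(n, x) = p_a^j, and Q_a^s consists of the multiples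
-- of p_a^s sharing a prime with R.  Counting, with n = t R p_a^s,
--   |Z_a^s| + 2 t φ(R) = t R + #{x < n | x coprime to R},
-- and passing from s to s + 1 replaces t by t / p_a, so |Z_a^s| − |Z_a^{s+1}| has the sign of
-- (p_a − 1)(t / p_a)(R − 2 φ(R)).
module Submission where

open import Defs
open import Data.Nat using (ℕ; _<_; _≤_; _*_; suc)
open import Data.Nat.Primality using (Prime)
open import Data.Fin using (Fin)
open import Data.Fin.Base as F using ()
open import Data.Product using (_×_)

open import Data.Bool using (Bool; true; false; T; if_then_else_; _∧_; _∨_; not; _xor_)
open import Data.Bool.ListAction using (any)
open import Data.Bool.Properties using (∧-identityʳ)
open import Data.Empty using (⊥-elim)
open import Data.Fin as Fin using (punchIn; punchOut) renaming (_≟_ to _≟ᶠ_)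
open import Data.Fin.Properties as Finₚ using (punchInᵢ≢i; punchIn-punchOut)
open import Data.List using (upTo; allFin; map; tabulate; applyUpTo)
open import Data.List.Membership.Propositional using (find; lose)
open import Data.List.Membership.Propositional.Properties using (∈-tabulate⁺; ∈-upTo⁺; ∈-upTo⁻; ∈-allFin)
open import Data.List.Properties using (map-tabulate; map-upTo)
open import Data.List.Relation.Unary.All.Properties using (tabulate⁺)
open import Data.List.Relation.Unary.Any.Properties using (any⇔)
open import Data.Nat using (zero; _+_; _^_; _∸_; _/_; _≡ᵇ_; pred; NonZero; z≤n; s≤s; z<s; s<s;
                            >-nonZero; ≢-nonZero; ≢-nonZero⁻¹; nonTrivial⇒n>1)
open import Data.Nat.Coprimality using (Coprime; coprime?; coprime-+; coprime-divisor) renaming (sym to coprime-sym)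
open import Data.Nat.DivMod using (m/n*n≡m; m*n/n≡m; m/n≤m; m≥n⇒m/n>0; /-congʳ)
open import Data.Nat.Divisibility
open import Data.Nat.GCD using (gcd; gcd[m,n]∣m; gcd[m,n]∣n; gcd-greatest; gcd[m,n]≢0; c*gcd[m,n]≡gcd[cm,cn])
open import Data.Nat.ListAction using (product)
open import Data.Nat.ListAction.Properties using (∈⇒∣product; product≢0)
open import Data.Nat.Primality using (prime⇒irreducible; prime⇒nonTrivial; prime⇒nonZero)
open import Data.Nat.Properties
open import Data.Nat.Tactic.RingSolver using (solve-∀)
open import Data.Product using (_,_; ∃)
open import Data.Sum using (inj₁; inj₂)
open import Data.Unit using (tt)
open import Function using (_∘_; id; const; _⇔_; mk⇔; Equivalence)
open import Function.Construct.Composition using (_⇔-∘_)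
open import Relation.Binary using (tri<; tri≈; tri>)
open import Relation.Binary.PropositionalEquality
open import Relation.Nullary using (Dec; yes; no; does; ¬_; _×-dec_; ¬?)
open import Relation.Nullary.Decidable using (does-⇔; dec-true; dec-false; T?)

private variable
  d m k x : ℕ

#< : ℕ → (ℕ → Bool) → ℕ
#< zero    P = 0
#< (suc n) P = if P 0 then suc (#< n (P ∘ suc)) else #< n (P ∘ suc)

count-applyUpTo : ∀ (P : ℕ → Bool) f n → count P (applyUpTo f n) ≡ #< n (P ∘ f)
count-applyUpTo P f zero = refl
count-applyUpTo P f (suc n) with P (f 0)
... | true  = cong suc (count-applyUpTo P (f ∘ suc) n)
... | false = count-applyUpTo P (f ∘ suc) n

#<-cong : ∀ {P Q : ℕ → Bool} n → (∀ x → x < n → P x ≡ Q x) → #< n P ≡ #< n Q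
#<-cong zero P≡Q = refl
#<-cong {P} {Q} (suc n) P≡Q with P 0 | Q 0 | P≡Q 0 z<s
... | true  | true  | _ = cong suc (#<-cong n (λ x x<n → P≡Q (suc x) (s<s x<n)))
... | false | false | _ = #<-cong n (λ x x<n → P≡Q (suc x) (s<s x<n))

#<-+ : ∀ (P : ℕ → Bool) m k → #< (m + k) P ≡ #< m P + #< k (λ x → P (m + x))
#<-+ P zero    k = refl
#<-+ P (suc m) k with P 0
... | true  = cong suc (#<-+ (P ∘ suc) m k)
... | false = #<-+ (P ∘ suc) m k

#<-true : ∀ n → #< n (const true) ≡ n
#<-true zero    = refl
#<-true (suc n) = cong suc (#<-true n)

#<-false : ∀ {P : ℕ → Bool} n → (∀ x → x < n → P x ≡ false) → #< n P ≡ 0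
#<-false zero    _       = refl
#<-false {P} (suc n) P≡false rewrite P≡false 0 z<s = #<-false n (λ x x<n → P≡false (suc x) (s<s x<n))

#<-periodic : ∀ (P : ℕ → Bool) R → (∀ x → P (R + x) ≡ P x) → ∀ t → #< (t * R) P ≡ t * #< R P
#<-periodic P R per zero    = refl
#<-periodic P R per (suc t) = begin
  #< (R + t * R) P                        ≡⟨ #<-+ P R (t * R) ⟩
  #< R P + #< (t * R) (λ x → P (R + x))   ≡⟨ cong (#< R P +_) (#<-cong (t * R) (λ x _ → per x)) ⟩
  #< R P + #< (t * R) P                   ≡⟨ cong (#< R P +_) (#<-periodic P R per t) ⟩
  #< R P + t * #< R P                     ∎
  where open ≡-Reasoning

#<-window : ∀ (P : ℕ → Bool) R → (∀ x → P (R + x) ≡ P x) → ∀ k → #< R (λ x → P (k + x)) ≡ #< R P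
#<-window P R per k = +-cancelˡ-≡ (#< k P) _ _ (begin
  #< k P + #< R (λ x → P (k + x))  ≡⟨ #<-+ P k R ⟨
  #< (k + R) P                     ≡⟨ cong (λ m → #< m P) (+-comm k R) ⟩
  #< (R + k) P                     ≡⟨ #<-+ P R k ⟩
  #< R P + #< k (λ x → P (R + x))  ≡⟨ cong (#< R P +_) (#<-cong k (λ x _ → per x)) ⟩
  #< R P + #< k P                  ≡⟨ +-comm (#< R P) (#< k P) ⟩
  #< k P + #< R P                  ∎)
  where open ≡-Reasoning

#<-multiples : ∀ d .{{_ : NonZero d}} (P : ℕ → Bool) M →
               #< (M * d) (λ x → does (d ∣? x) ∧ P x) ≡ #< M (λ y → P (y * d))
#<-multiples d          P zero    = refl
#<-multiples d@(suc d′) P (suc M) = begin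
  #< (d + M * d) (λ x → does (d ∣? x) ∧ P x)
    ≡⟨ #<-+ (λ x → does (d ∣? x) ∧ P x) d (M * d) ⟩
  #< d (λ x → does (d ∣? x) ∧ P x) + #< (M * d) (λ x → does (d ∣? (d + x)) ∧ P (d + x))
    ≡⟨ cong₂ _+_ first-period (#<-cong (M * d) (λ x _ → cong (_∧ P (d + x)) (d∣?d+x≡d∣?x x))) ⟩
  #< 1 P + #< (M * d) (λ x → does (d ∣? x) ∧ P (d + x))
    ≡⟨ cong (#< 1 P +_) (#<-multiples d (λ x → P (d + x)) M) ⟩
  #< 1 P + #< M (λ y → P (d + y * d))
    ≡⟨ #<-+ (λ y → P (y * d)) 1 M ⟨
  #< (suc M) (λ y → P (y * d)) ∎
  where
  open ≡-Reasoning
  d∣?d+x≡d∣?x : ∀ x → does (d ∣? (d + x)) ≡ does (d ∣? x)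
  d∣?d+x≡d∣?x x = does-⇔ (mk⇔ (λ d∣d+x → ∣m+n∣m⇒∣n d∣d+x ∣-refl) (∣m∣n⇒∣m+n ∣-refl)) (d ∣? (d + x)) (d ∣? x)
  d∤ : ∀ x → x < d′ → (does (d ∣? suc x) ∧ P (suc x)) ≡ false
  d∤ x x<d′ = cong (_∧ P (suc x)) (dec-false (d ∣? suc x) (λ d∣ → <⇒≱ (s<s x<d′) (∣⇒≤ d∣)))
  first-period : #< d (λ x → does (d ∣? x) ∧ P x) ≡ #< 1 P
  first-period rewrite #<-false {λ x → does (d ∣? suc x) ∧ P (suc x)} d′ d∤ = refl

#<-xor : ∀ (P Q : ℕ → Bool) n → #< n (λ x → P x xor Q x) + 2 * #< n (λ x → P x ∧ Q x) ≡ #< n P + #< n Q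
#<-xor P Q zero = refl
#<-xor P Q (suc n) with P 0 | Q 0 | #<-xor (P ∘ suc) (Q ∘ suc) n
... | true  | true  | ih = trans (x+2[1+y]≡2+x+2y _ _) (trans (cong (suc ∘ suc) ih) (cong suc (sym (+-suc _ _))))
  where
  x+2[1+y]≡2+x+2y : ∀ x y → x + 2 * suc y ≡ suc (suc (x + 2 * y))
  x+2[1+y]≡2+x+2y = solve-∀
... | true  | false | ih = cong suc ih
... | false | true  | ih = trans (cong suc ih) (sym (+-suc _ _))
... | false | false | ih = ih

T-does : ∀ {A : Set} (a? : Dec A) → T (does a?) ⇔ A
T-does (yes a) = mk⇔ (const a) (const tt)
T-does (no ¬a) = mk⇔ (λ ()) ¬a

T-any-upTo : ∀ (f : ℕ → Bool) s → T (any f (upTo s)) ⇔ (∃ λ j → j < s × T (f j))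
T-any-upTo f s = mk⇔
  (λ t → let j , j∈ , fj = find (Equivalence.from (any⇔ {xs = upTo s}) t) in j , ∈-upTo⁻ j∈ , fj)
  (λ (j , j<s , fj) → Equivalence.to any⇔ (lose (∈-upTo⁺ j<s) fj))

T-any-allFin : ∀ {r} (f : Fin r → Bool) → T (any f (allFin r)) ⇔ (∃ λ i → T (f i))
T-any-allFin f = mk⇔
  (λ t → let i , _ , fi = find (Equivalence.from (any⇔ {xs = allFin _}) t) in i , fi)
  (λ (i , fi) → Equivalence.to any⇔ (lose (∈-allFin i) fi))

symmetric-difference≡xor : ∀ b c → (not b ∧ c) ∨ (b ∧ not c) ≡ b xor c
symmetric-difference≡xor true  true  = refl
symmetric-difference≡xor true  false = refl
symmetric-difference≡xor false true  = refl
symmetric-difference≡xor false false = refl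

affine-difference : ∀ {Z₁ Z₂ c k d Φ R} →
                    Z₁ + 2 * ((k + d) * Φ) ≡ (k + d) * R + c → Z₂ + 2 * (k * Φ) ≡ k * R + c →
                    Z₁ + d * (2 * Φ) ≡ Z₂ + d * R
affine-difference {Z₁} {Z₂} {c} {k} {d} {Φ} {R} eq₁ eq₂ = +-cancelʳ-≡ (2 * (k * Φ) + k * R) _ _ (begin
  Z₁ + d * (2 * Φ) + (2 * (k * Φ) + k * R) ≡⟨ lhs Z₁ k d Φ R ⟩
  Z₁ + 2 * ((k + d) * Φ) + k * R           ≡⟨ cong (_+ k * R) eq₁ ⟩
  (k + d) * R + c + k * R                  ≡⟨ middle k d c R ⟩
  (k * R + c) + d * R + k * R              ≡⟨ cong (λ m → m + d * R + k * R) eq₂ ⟨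
  (Z₂ + 2 * (k * Φ)) + d * R + k * R       ≡⟨ rhs Z₂ k d Φ R ⟩
  Z₂ + d * R + (2 * (k * Φ) + k * R)       ∎)
  where
  open ≡-Reasoning
  lhs : ∀ Z k d Φ R → Z + d * (2 * Φ) + (2 * (k * Φ) + k * R) ≡ Z + 2 * ((k + d) * Φ) + k * R
  lhs = solve-∀
  middle : ∀ k d c R → (k + d) * R + c + k * R ≡ (k * R + c) + d * R + k * R
  middle = solve-∀
  rhs : ∀ Z k d Φ R → (Z + 2 * (k * Φ)) + d * R + k * R ≡ Z + d * R + (2 * (k * Φ) + k * R)
  rhs = solve-∀

+-*-balance⇒< : ∀ {x y a b} d .{{_ : NonZero d}} → x + d * a ≡ y + d * b → b < a → x < y
+-*-balance⇒< {x} {y} d eq b<a with x <? y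
... | yes x<y = x<y
... | no  x≮y = ⊥-elim (<-irrefl (sym eq) (+-mono-≤-< (≮⇒≥ x≮y) (*-monoʳ-< d b<a)))

prime>1 : ∀ {p} → Prime p → 1 < p
prime>1 {p} p-prime = nonTrivial⇒n>1 p {{prime⇒nonTrivial p-prime}}

coprime-∣ʳ : d ∣ m → Coprime x m → Coprime x d
coprime-∣ʳ d∣m c (e∣x , e∣d) = c (e∣x , ∣-trans e∣d d∣m)

coprime-*ʳ : Coprime x m → Coprime x k → Coprime x (m * k)
coprime-*ʳ c₁ c₂ (d∣x , d∣mk) =
  c₂ (d∣x , coprime-divisor (λ (e∣d , e∣m) → c₁ (∣-trans e∣d d∣x , e∣m)) d∣mk)

coprime-^ʳ : Coprime x m → ∀ k → Coprime x (m ^ k)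
coprime-^ʳ c zero    (_ , d∣1) = ∣1⇒≡1 d∣1
coprime-^ʳ c (suc k) = coprime-*ʳ c (coprime-^ʳ c k)

prime∤⇒coprime : ∀ {p} → Prime p → ¬ p ∣ x → Coprime x p
prime∤⇒coprime p-prime p∤x (d∣x , d∣p) with prime⇒irreducible p-prime d∣p
... | inj₁ d≡1    = d≡1
... | inj₂ refl   = ⊥-elim (p∤x d∣x)

prime∣⇒¬coprime : ∀ {p} → Prime p → p ∣ x → p ∣ m → ¬ Coprime x m
prime∣⇒¬coprime p-prime p∣x p∣m c = <⇒≢ (prime>1 p-prime) (sym (c (p∣x , p∣m)))

∣-product : ∀ {n} (f : Fin n → ℕ) i → f i ∣ product (tabulate f)
∣-product f i = ∈⇒∣product (∈-tabulate⁺ i)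

product-∣ : ∀ {n} (f g : Fin n → ℕ) → (∀ i → f i ∣ g i) → product (tabulate f) ∣ product (tabulate g)
product-∣ {zero}  f g _   = ∣-refl
product-∣ {suc n} f g f∣g = *-pres-∣ (f∣g Fin.zero) (product-∣ (f ∘ Fin.suc) (g ∘ Fin.suc) (f∣g ∘ Fin.suc))

coprime-product : ∀ {n} (f : Fin n → ℕ) → (∀ i → Coprime x (f i)) → Coprime x (product (tabulate f))
coprime-product {n = zero}  f c (_ , d∣1) = ∣1⇒≡1 d∣1
coprime-product {n = suc n} f c = coprime-*ʳ (c Fin.zero) (coprime-product (f ∘ Fin.suc) (c ∘ Fin.suc))

coprime-product-^ : ∀ {n} (f : Fin n → ℕ) (e : Fin n → ℕ) →
                    Coprime x (product (tabulate f)) → Coprime x (product (tabulate (λ i → f i ^ e i)))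
coprime-product-^ f e c = coprime-product _ (λ i → coprime-^ʳ (coprime-∣ʳ (∣-product f i) c) (e i))

¬coprime-product⇔ : ∀ {n} (f : Fin n → ℕ) → (∀ i → Prime (f i)) →
                    (¬ Coprime x (product (tabulate f))) ⇔ (∃ λ i → f i ∣ x)
¬coprime-product⇔ {x} f f-prime = mk⇔ (divisor f f-prime) λ (i , fi∣x) →
  prime∣⇒¬coprime (f-prime i) fi∣x (∣-product f i)
  where
  divisor : ∀ {n} (f : Fin n → ℕ) → (∀ i → Prime (f i)) → ¬ Coprime x (product (tabulate f)) → ∃ λ i → f i ∣ x
  divisor {zero}  f _ ¬c = ⊥-elim (¬c (λ (_ , d∣1) → ∣1⇒≡1 d∣1))
  divisor {suc n} f f-prime ¬c with f Fin.zero ∣? x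
  ... | yes f₀∣x = Fin.zero , f₀∣x
  ... | no  f₀∤x =
    let i , fi∣x = divisor (f ∘ Fin.suc) (f-prime ∘ Fin.suc) (¬c ∘ coprime-*ʳ (prime∤⇒coprime (f-prime Fin.zero) f₀∤x))
    in Fin.suc i , fi∣x

distinct-primes-coprime : ∀ {p q} → Prime p → Prime q → p ≢ q → Coprime p q
distinct-primes-coprime p-prime q-prime p≢q =
  prime∤⇒coprime q-prime (λ q∣p → p≢q (sym (prime∣prime q-prime p-prime q∣p)))
  where
  prime∣prime : ∀ {q p} → Prime q → Prime p → q ∣ p → q ≡ p
  prime∣prime q-prime p-prime q∣p with prime⇒irreducible p-prime q∣p
  ... | inj₂ q≡p = q≡p
  ... | inj₁ refl = ⊥-elim (<-irrefl refl (prime>1 q-prime))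

product-punchIn : ∀ {n} (f : Fin (suc n) → ℕ) a → product (tabulate f) ≡ f a * product (tabulate (f ∘ punchIn a))
product-punchIn f Fin.zero = refl
product-punchIn {suc n} f (Fin.suc a) = begin
  f Fin.zero * product (tabulate (f ∘ Fin.suc))                     ≡⟨ cong (f Fin.zero *_) (product-punchIn (f ∘ Fin.suc) a) ⟩
  f Fin.zero * (f (Fin.suc a) * product (tabulate (f ∘ Fin.suc ∘ punchIn a))) ≡⟨ x*[y*z]≡y*[x*z] (f Fin.zero) (f (Fin.suc a)) _ ⟩
  f (Fin.suc a) * (f Fin.zero * product (tabulate (f ∘ Fin.suc ∘ punchIn a))) ∎
  where
  open ≡-Reasoning
  x*[y*z]≡y*[x*z] : ∀ x y z → x * (y * z) ≡ y * (x * z)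
  x*[y*z]≡y*[x*z] x y z = trans (sym (*-assoc x y z)) (trans (cong (_* z) (*-comm x y)) (*-assoc y x z))

^-∣-^ : ∀ m {j k} → j ≤ k → m ^ j ∣ m ^ k
^-∣-^ m {j} {k} j≤k = divides (m ^ (k ∸ j)) (begin
  m ^ k              ≡⟨ cong (m ^_) (m∸n+n≡m j≤k) ⟨
  m ^ (k ∸ j + j)    ≡⟨ ^-distribˡ-+-* m (k ∸ j) j ⟩
  m ^ (k ∸ j) * m ^ j ∎)
  where open ≡-Reasoning

m∣m^k : ∀ m {k} → 1 ≤ k → m ∣ m ^ k
m∣m^k m {suc k} _ = m∣m*n (m ^ k)

∣-prime-power : ∀ {p} → Prime p → ∀ k → d ∣ p ^ k → ∃ λ j → j ≤ k × d ≡ p ^ j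
∣-prime-power p-prime zero d∣1 = 0 , z≤n , ∣1⇒≡1 d∣1
∣-prime-power {d} {p} p-prime (suc k) d∣p^k+1 with p ∣? d
... | no p∤d =
  let j , j≤k , d≡ = ∣-prime-power p-prime k (coprime-divisor (prime∤⇒coprime p-prime p∤d) d∣p^k+1)
  in j , m≤n⇒m≤1+n j≤k , d≡
... | yes (divides d′ refl) =
  let j , j≤k , d′≡ = ∣-prime-power p-prime k (*-cancelʳ-∣ p (subst (d′ * p ∣_) (*-comm p (p ^ k)) d∣p^k+1))
  in suc j , s≤s j≤k , trans (*-comm d′ p) (cong (p *_) d′≡)
  where instance _ = prime⇒nonZero p-prime

coprime-*-∣ : Coprime m k → m ∣ x → k ∣ x → m * k ∣ x
coprime-*-∣ {m} {k} c m∣x (divides t refl) = *-monoˡ-∣ k (coprime-divisor c (subst (m ∣_) (*-comm t k) m∣x))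

n∣[n/q]*x⇔q∣x : ∀ {n q} .{{_ : NonZero n}} .{{_ : NonZero q}} → q ∣ n → n ∣ (n / q) * x ⇔ q ∣ x
n∣[n/q]*x⇔q∣x {x} {n} {q} q∣n = mk⇔
  (λ n∣ → *-cancelˡ-∣ (n / q) (subst (_∣ (n / q) * x) (sym [n/q]*q≡n) n∣))
  (λ q∣x → subst (_∣ (n / q) * x) [n/q]*q≡n (*-monoʳ-∣ (n / q) q∣x))
  where
  [n/q]*q≡n : n / q * q ≡ n
  [n/q]*q≡n = m/n*n≡m q∣n
  instance _ = >-nonZero (m≥n⇒m/n>0 (∣⇒≤ q∣n))

m/n≡m/o⇒n≡o : ∀ {m n o} .{{_ : NonZero m}} .{{_ : NonZero n}} .{{_ : NonZero o}} →
              n ∣ m → o ∣ m → m / n ≡ m / o → n ≡ o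
m/n≡m/o⇒n≡o {m} {n} {o} n∣m o∣m eq = *-cancelˡ-≡ n o (m / o) (begin
  m / o * n ≡⟨ cong (_* n) eq ⟨
  m / n * n ≡⟨ m/n*n≡m n∣m ⟩
  m         ≡⟨ m/n*n≡m o∣m ⟨
  m / o * o ∎)
  where
  open ≡-Reasoning
  instance _ = >-nonZero (m≥n⇒m/n>0 (∣⇒≤ o∣m))

first-applyUpTo : ∀ (P : ℕ → Bool) f {m} k → k < m → P (f k) ≡ true →
                  (∀ j → j < k → P (f j) ≡ false) → first P (applyUpTo f m) ≡ f k
first-applyUpTo P f {suc m} zero    _         Pfk _ rewrite Pfk = refl
first-applyUpTo P f {suc m} (suc k) (s<s k<m) Pfk earlier rewrite earlier 0 z<s =
  first-applyUpTo P (f ∘ suc) k k<m Pfk (λ j j<k → earlier (suc j) (s<s j<k))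

gcd≢0 : ∀ n x .{{_ : NonZero n}} → NonZero (gcd n x)
gcd≢0 n x = ≢-nonZero (gcd[m,n]≢0 n x (inj₁ (≢-nonZero⁻¹ n)))

module _ (n : ℕ) .{{_ : NonZero n}} (x : ℕ) where

  private instance _ = gcd≢0 n x

  ∣*⇔n/gcd∣ : ∀ k → n ∣ k * x ⇔ n / gcd n x ∣ k
  ∣*⇔n/gcd∣ k = mk⇔ to from
    where
    to : n ∣ k * x → n / gcd n x ∣ k
    to n∣kx = m∣n*o⇒m/n∣o (gcd[m,n]∣m n x)
      (subst (n ∣_) (sym (c*gcd[m,n]≡gcd[cm,cn] k n x))
        (gcd-greatest (n∣m*n k) n∣kx))
    from : n / gcd n x ∣ k → n ∣ k * x
    from n/g∣k = ∣-trans (m/n∣o⇒m∣o*n (gcd[m,n]∣m n x) n/g∣k) (*-monoʳ-∣ k (gcd[m,n]∣n n x))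

  ord≡n/gcd : ord n x ≡ n / gcd n x
  ord≡n/gcd with n / gcd n x in n/g≡ | m≥n⇒m/n>0 {n} {gcd n x} (∣⇒≤ (gcd[m,n]∣m n x))
  ... | suc k | _ = trans (cong (first P) (map-upTo suc n))
                          (first-applyUpTo P suc k k<n (dec-true (n ∣? (suc k * x)) multiple) minimal)
    where
    P : ℕ → Bool
    P k = does (n ∣? (k * x))
    k<n : k < n
    k<n = subst (_≤ n) n/g≡ (m/n≤m n (gcd n x))
    multiple : n ∣ suc k * x
    multiple = Equivalence.from (∣*⇔n/gcd∣ (suc k)) (subst (_∣ suc k) (sym n/g≡) ∣-refl)
    minimal : ∀ j → j < k → P (suc j) ≡ false
    minimal j j<k = dec-false (n ∣? (suc j * x)) λ n∣ →
      <⇒≱ (s<s j<k) (subst (_≤ suc j) n/g≡ (∣⇒≤ (Equivalence.to (∣*⇔n/gcd∣ (suc j)) n∣)))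

div≡/ : ∀ m q .{{_ : NonZero q}} → m div q ≡ m / q
div≡/ m (suc q) = refl

module Factorisation (r : ℕ) (p e : Fin (suc r) → ℕ) (a : Fin (suc r))
               (p-prime : ∀ i → Prime (p i)) (p-injective : ∀ {i j} → p i ≡ p j → i ≡ j)
               (e≥1 : ∀ i → 1 ≤ e i) where

  P n R : ℕ
  P = p a
  n = nOf (suc r) p e a
  R = radQuot (suc r) p e a

  Z : ℕ → ℕ
  Z = cardZ (suc r) p e a

  q : Fin r → ℕ
  q = p ∘ punchIn a

  M : ℕ
  M = product (tabulate (λ j → q j ^ e (punchIn a j)))

  instance
    P≢0 : NonZero P
    P≢0 = prime⇒nonZero (p-prime a)

  n≡P^e*M : n ≡ P ^ e a * M
  n≡P^e*M = trans (cong product (map-tabulate id (λ i → p i ^ e i))) (product-punchIn (λ i → p i ^ e i) a)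

  R≡∏q : R ≡ product (tabulate q)
  R≡∏q = begin
    product (map p (allFin (suc r))) div P ≡⟨ div≡/ _ P ⟩
    product (map p (allFin (suc r))) / P  ≡⟨ cong (λ m → m / P) (cong product (map-tabulate id p)) ⟩
    product (tabulate p) / P              ≡⟨ cong (_/ P) (product-punchIn p a) ⟩
    P * product (tabulate q) / P          ≡⟨ cong (_/ P) (*-comm P _) ⟩
    product (tabulate q) * P / P          ≡⟨ m*n/n≡m _ P ⟩
    product (tabulate q)                  ∎
    where open ≡-Reasoning

  q-prime : ∀ j → Prime (q j)
  q-prime = p-prime ∘ punchIn a

  instance
    n≢0 : NonZero n
    n≢0 = subst NonZero (sym n≡P^e*M)
      (m*n≢0 _ _ {{m^n≢0 P (e a)}} {{product≢0 (tabulate⁺ λ j → m^n≢0 (q j) (e (punchIn a j)) {{prime⇒nonZero (q-prime j)}})}})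

  R∣M : R ∣ M
  R∣M = subst (_∣ M) (sym R≡∏q) (product-∣ q _ (λ j → m∣m^k (q j) (e≥1 (punchIn a j))))

  M∣n : M ∣ n
  M∣n = subst (M ∣_) (sym n≡P^e*M) (n∣m*n (P ^ e a))

  P^s∣n : ∀ {s} → s ≤ e a → P ^ s ∣ n
  P^s∣n {s} s≤e = subst (P ^ s ∣_) (sym n≡P^e*M) (∣m⇒∣m*n M (^-∣-^ P s≤e))

  p∣R : ∀ {i} → i ≢ a → p i ∣ R
  p∣R {i} i≢a = subst₂ _∣_ (cong p (punchIn-punchOut (i≢a ∘ sym))) (sym R≡∏q) (∣-product q (punchOut (i≢a ∘ sym)))

  coprime-P^s-R : ∀ s → Coprime (P ^ s) R
  coprime-P^s-R s = coprime-sym (coprime-^ʳ (coprime-sym coprime-P-R) s)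
    where
    coprime-P-R : Coprime P R
    coprime-P-R = subst (Coprime P) (sym R≡∏q) (coprime-product q λ j →
      distinct-primes-coprime (p-prime a) (q-prime j) (λ P≡qj → punchInᵢ≢i a j (sym (p-injective P≡qj))))

  divisible-by-other-prime⇔ : ∀ {x} → (∃ λ i → i ≢ a × p i ∣ x) ⇔ (¬ Coprime x R)
  divisible-by-other-prime⇔ {x} = mk⇔
    (λ (i , i≢a , pi∣x) → prime∣⇒¬coprime (p-prime i) pi∣x (p∣R i≢a))
    (λ ¬c → let j , qj∣x = Equivalence.to (¬coprime-product⇔ q q-prime) (¬c ∘ subst (Coprime x) (sym R≡∏q))
            in punchIn a j , punchInᵢ≢i a j , qj∣x)

  coprimeᵇ : ℕ → Bool
  coprimeᵇ x = does (coprime? x R)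

  divisibleᵇ : ℕ → ℕ → Bool
  divisibleᵇ s x = does (P ^ s ∣? x)

  gcd≡P^⇔ : ∀ {s x} → s ≤ e a → (∃ λ j → j < s × gcd n x ≡ P ^ j) ⇔ (¬ P ^ s ∣ x × Coprime x R)
  gcd≡P^⇔ {s} {x} s≤e = mk⇔ to from
    where
    to : (∃ λ j → j < s × gcd n x ≡ P ^ j) → ¬ P ^ s ∣ x × Coprime x R
    to (j , j<s , g≡P^j) = not-divisible , coprime
      where
      instance _ = m^n≢0 P j
      coprime : Coprime x R
      coprime (d∣x , d∣R) =
        coprime-P^s-R j (subst (_ ∣_) g≡P^j (gcd-greatest (∣-trans d∣R (∣-trans R∣M M∣n)) d∣x) , d∣R)
      not-divisible : ¬ P ^ s ∣ x
      not-divisible P^s∣x = <⇒≱ (^-monoʳ-< P (prime>1 (p-prime a)) j<s)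
        (∣⇒≤ (subst (_ ∣_) g≡P^j (gcd-greatest (P^s∣n s≤e) P^s∣x)))
    from : ¬ P ^ s ∣ x × Coprime x R → ∃ λ j → j < s × gcd n x ≡ P ^ j
    from (not-divisible , coprime) with ∣-prime-power (p-prime a) (e a) g∣P^e
      where
      coprime-g-M : Coprime (gcd n x) M
      coprime-g-M = coprime-sym (coprime-∣ʳ (gcd[m,n]∣n n x)
        (coprime-sym (coprime-product-^ q (e ∘ punchIn a) (subst (Coprime x) R≡∏q coprime))))
      g∣P^e : gcd n x ∣ P ^ e a
      g∣P^e = coprime-divisor coprime-g-M (subst (gcd n x ∣_) (trans n≡P^e*M (*-comm _ M)) (gcd[m,n]∣m n x))
    ... | j , _ , g≡P^j with j <? s
    ...   | yes j<s = j , j<s , g≡P^j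
    ...   | no  j≮s = ⊥-elim (not-divisible (∣-trans (^-∣-^ P (≮⇒≥ j≮s)) (subst (_∣ x) g≡P^j (gcd[m,n]∣n n x))))

  inE⇔gcd≡ : ∀ {j x} → j ≤ e a → T (inE n (n div (P ^ j)) x) ⇔ gcd n x ≡ P ^ j
  inE⇔gcd≡ {j} {x} j≤e = mk⇔ to from ⇔-∘ T-does (ord n x ≟ n div (P ^ j))
    where
    instance
      _ = m^n≢0 P j
      _ = gcd≢0 n x
    to : ord n x ≡ n div (P ^ j) → gcd n x ≡ P ^ j
    to ord≡ = m/n≡m/o⇒n≡o (gcd[m,n]∣m n x) (P^s∣n j≤e) (trans (sym (ord≡n/gcd n x)) (trans ord≡ (div≡/ n (P ^ j))))
    from : gcd n x ≡ P ^ j → ord n x ≡ n div (P ^ j)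
    from g≡P^j = trans (ord≡n/gcd n x) (trans (/-congʳ g≡P^j) (sym (div≡/ n (P ^ j))))

  lowerOrders≡ : ∀ {s x} → s ≤ e a →
                 any (λ j → inE n (n div (P ^ j)) x) (upTo s) ≡ not (divisibleᵇ s x) ∧ coprimeᵇ x
  lowerOrders≡ {s} {x} s≤e =
    does-⇔ (gcd≡P^⇔ s≤e ⇔-∘ (orders ⇔-∘ T-any-upTo _ s)) (T? _) (¬? (P ^ s ∣? x) ×-dec coprime? x R)
    where
    orders : (∃ λ j → j < s × T (inE n (n div (P ^ j)) x)) ⇔ (∃ λ j → j < s × gcd n x ≡ P ^ j)
    orders = mk⇔ (λ (j , j<s , t) → j , j<s , Equivalence.to   (inE⇔gcd≡ (≤-trans (<⇒≤ j<s) s≤e)) t)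
                 (λ (j , j<s , g) → j , j<s , Equivalence.from (inE⇔gcd≡ (≤-trans (<⇒≤ j<s) s≤e)) g)

  p*P^s∣n : ∀ {i s} → i ≢ a → s ≤ e a → p i * P ^ s ∣ n
  p*P^s∣n {i} {s} i≢a s≤e = subst (p i * P ^ s ∣_) (sym (trans n≡P^e*M (*-comm _ M)))
    (*-pres-∣ (∣-trans (p∣R i≢a) R∣M) (^-∣-^ P s≤e))

  n∣n/[p*P^s]*x⇔ : ∀ {i s x} → i ≢ a → s ≤ e a → n ∣ n div (p i * P ^ s) * x ⇔ p i * P ^ s ∣ x
  n∣n/[p*P^s]*x⇔ {i} {s} {x} i≢a s≤e =
    subst (λ m → n ∣ m * x ⇔ p i * P ^ s ∣ x) (sym (div≡/ n (p i * P ^ s))) (n∣[n/q]*x⇔q∣x (p*P^s∣n i≢a s≤e))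
    where instance _ = m*n≢0 (p i) (P ^ s) {{prime⇒nonZero (p-prime i)}} {{m^n≢0 P s}}

  inQ≡ : ∀ {s x} → s ≤ e a → inQ (suc r) p e a s x ≡ divisibleᵇ s x ∧ not (coprimeᵇ x)
  inQ≡ {s} {x} s≤e = does-⇔ (mk⇔ to from ⇔-∘ T-any-allFin _) (T? _) ((P ^ s ∣? x) ×-dec ¬? (coprime? x R))
    where
    entry : ∀ i → T (not (does (i ≟ᶠ a)) ∧ inS n (n div (p i * P ^ s)) x) ⇔ (i ≢ a × p i * P ^ s ∣ x)
    entry i = mk⇔ (λ (i≢a , n∣) → i≢a , Equivalence.to (n∣n/[p*P^s]*x⇔ i≢a s≤e) n∣)
                  (λ (i≢a , d) → i≢a , Equivalence.from (n∣n/[p*P^s]*x⇔ i≢a s≤e) d)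
              ⇔-∘ T-does (¬? (i ≟ᶠ a) ×-dec (n ∣? (n div (p i * P ^ s) * x)))
    to : (∃ λ i → T (not (does (i ≟ᶠ a)) ∧ inS n (n div (p i * P ^ s)) x)) → P ^ s ∣ x × ¬ Coprime x R
    to (i , t) = let i≢a , d = Equivalence.to (entry i) t in
      m*n∣⇒n∣ (p i) (P ^ s) d , Equivalence.to divisible-by-other-prime⇔ (i , i≢a , m*n∣⇒m∣ (p i) (P ^ s) d)
    from : P ^ s ∣ x × ¬ Coprime x R → ∃ λ i → T (not (does (i ≟ᶠ a)) ∧ inS n (n div (p i * P ^ s)) x)
    from (P^s∣x , ¬c) = let i , i≢a , pi∣x = Equivalence.from divisible-by-other-prime⇔ ¬c in
      i , Equivalence.from (entry i)
            (i≢a , coprime-*-∣ (coprime-sym (coprime-∣ʳ (p∣R i≢a) (coprime-P^s-R s))) pi∣x P^s∣x)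

  inZ≡xor : ∀ {s x} → s ≤ e a → inZ (suc r) p e a s x ≡ divisibleᵇ s x xor coprimeᵇ x
  inZ≡xor {s} {x} s≤e = trans (cong₂ _∨_ (lowerOrders≡ s≤e) (inQ≡ s≤e))
                              (symmetric-difference≡xor (divisibleᵇ s x) (coprimeᵇ x))

  coprimeᵇ-periodic : ∀ x → coprimeᵇ (R + x) ≡ coprimeᵇ x
  coprimeᵇ-periodic x = does-⇔ (mk⇔ to coprime-+) (coprime? (R + x) R) (coprime? x R)
    where
    to : Coprime (R + x) R → Coprime x R
    to c (d∣x , d∣R) = c (∣m∣n⇒∣m+n d∣R d∣x , d∣R)

  coprimeᵇ-*P^ : ∀ s y → coprimeᵇ (y * P ^ s) ≡ coprimeᵇ y
  coprimeᵇ-*P^ s y = does-⇔ (mk⇔ to from) (coprime? (y * P ^ s) R) (coprime? y R)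
    where
    to : Coprime (y * P ^ s) R → Coprime y R
    to c = coprime-sym (coprime-∣ʳ (m∣m*n (P ^ s)) (coprime-sym c))
    from : Coprime y R → Coprime (y * P ^ s) R
    from c = coprime-sym (coprime-*ʳ (coprime-sym c) (coprime-sym (coprime-P^s-R s)))

  φR≡#coprime : φ R ≡ #< R coprimeᵇ
  -- φ counts over 1, …, R; periodicity moves the window to 0, …, R − 1.
  φR≡#coprime = begin
    count (λ k → gcd k R ≡ᵇ 1) (map suc (upTo R)) ≡⟨ cong (count _) (map-upTo suc R) ⟩
    count (λ k → gcd k R ≡ᵇ 1) (applyUpTo suc R)  ≡⟨ count-applyUpTo _ suc R ⟩
    #< R (λ x → coprimeᵇ (1 + x))                  ≡⟨ #<-window coprimeᵇ R coprimeᵇ-periodic 1 ⟩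
    #< R coprimeᵇ                                   ∎
    where open ≡-Reasoning

  #divisible : ∀ {s m} → n ≡ m * P ^ s → #< n (divisibleᵇ s) ≡ m
  #divisible {s} {m} n≡ = begin
    #< n (divisibleᵇ s)                          ≡⟨ #<-cong n (λ x _ → sym (∧-identityʳ (divisibleᵇ s x))) ⟩
    #< n (λ x → divisibleᵇ s x ∧ true)           ≡⟨ cong (λ k → #< k (λ x → divisibleᵇ s x ∧ true)) n≡ ⟩
    #< (m * P ^ s) (λ x → divisibleᵇ s x ∧ true) ≡⟨ #<-multiples (P ^ s) {{m^n≢0 P s}} (const true) m ⟩
    #< m (const true)                            ≡⟨ #<-true m ⟩
    m                                            ∎
    where open ≡-Reasoning

  #divisible-coprime : ∀ {s t} → n ≡ (t * R) * P ^ s → #< n (λ x → divisibleᵇ s x ∧ coprimeᵇ x) ≡ t * φ R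
  #divisible-coprime {s} {t} n≡ = begin
    #< n (λ x → divisibleᵇ s x ∧ coprimeᵇ x)            ≡⟨ cong (λ k → #< k (λ x → divisibleᵇ s x ∧ coprimeᵇ x)) n≡ ⟩
    #< (t * R * P ^ s) (λ x → divisibleᵇ s x ∧ coprimeᵇ x) ≡⟨ #<-multiples (P ^ s) {{m^n≢0 P s}} coprimeᵇ (t * R) ⟩
    #< (t * R) (λ y → coprimeᵇ (y * P ^ s))             ≡⟨ #<-cong (t * R) (λ y _ → coprimeᵇ-*P^ s y) ⟩
    #< (t * R) coprimeᵇ                                 ≡⟨ #<-periodic coprimeᵇ R coprimeᵇ-periodic t ⟩
    t * #< R coprimeᵇ                                   ≡⟨ cong (t *_) φR≡#coprime ⟨
    t * φ R                                             ∎
    where open ≡-Reasoning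

  Z-formula : ∀ {s t} → s ≤ e a → n ≡ (t * R) * P ^ s → Z s + 2 * (t * φ R) ≡ t * R + #< n coprimeᵇ
  Z-formula {s} {t} s≤e n≡ = begin
    Z s + 2 * (t * φ R)
      ≡⟨ cong₂ (λ k l → k + 2 * l) (count-applyUpTo (inZ (suc r) p e a s) id n) (sym (#divisible-coprime {s} {t} n≡)) ⟩
    #< n (inZ (suc r) p e a s) + 2 * #< n (λ x → divisibleᵇ s x ∧ coprimeᵇ x)
      ≡⟨ cong (_+ 2 * #< n (λ x → divisibleᵇ s x ∧ coprimeᵇ x)) (#<-cong n (λ x _ → inZ≡xor s≤e)) ⟩
    #< n (λ x → divisibleᵇ s x xor coprimeᵇ x) + 2 * #< n (λ x → divisibleᵇ s x ∧ coprimeᵇ x)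
      ≡⟨ #<-xor (divisibleᵇ s) coprimeᵇ n ⟩
    #< n (divisibleᵇ s) + #< n coprimeᵇ
      ≡⟨ cong (_+ #< n coprimeᵇ) (#divisible {s} n≡) ⟩
    t * R + #< n coprimeᵇ
      ∎
    where open ≡-Reasoning

  Z-step : ∀ {s} → s < e a → ∃ λ d → NonZero d × Z s + d * (2 * φ R) ≡ Z (suc s) + d * R
  Z-step {s} s<e with m≤n⇒∃[o]m+o≡n s<e | R∣M
  ... | t , s+1+t≡e | divides w M≡wR =
    pred P * u , d≢0 ,
    affine-difference {Z s} {Z (suc s)} {#< n coprimeᵇ} {u} {pred P * u} {φ R} {R}
      (Z-formula {t = suc (pred P) * u} (<⇒≤ s<e) n≡[Pu]RP^s) (Z-formula {t = u} s<e n≡uRP^s+1)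
    where
    u : ℕ
    u = P ^ t * w
    n≡uRP^s+1 : n ≡ (u * R) * P ^ suc s
    n≡uRP^s+1 = begin
      n                                ≡⟨ n≡P^e*M ⟩
      P ^ e a * M                      ≡⟨ cong₂ _*_ (cong (P ^_) (sym s+1+t≡e)) M≡wR ⟩
      P ^ (suc s + t) * (w * R)        ≡⟨ cong (_* (w * R)) (^-distribˡ-+-* P (suc s) t) ⟩
      (P ^ suc s * P ^ t) * (w * R)    ≡⟨ regroup (P ^ suc s) (P ^ t) w R ⟩
      (u * R) * P ^ suc s              ∎
      where
      open ≡-Reasoning
      regroup : ∀ A B w R → (A * B) * (w * R) ≡ ((B * w) * R) * A
      regroup = solve-∀
    n≡[Pu]RP^s : n ≡ ((suc (pred P) * u) * R) * P ^ s
    n≡[Pu]RP^s = trans n≡uRP^s+1 (trans (regroup P u R (P ^ s)) (cong (λ m → ((m * u) * R) * P ^ s) (sym (suc-pred P))))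
      where
      regroup : ∀ P u R Pˢ → (u * R) * (P * Pˢ) ≡ ((P * u) * R) * Pˢ
      regroup = solve-∀
    d≢0 : NonZero (pred P * u)
    d≢0 = m*n≢0 (pred P) u {{>-nonZero (pred-mono-≤ (prime>1 (p-prime a)))}}
            {{m*n≢0⇒m≢0 u {{m*n≢0⇒m≢0 (u * R) {{subst NonZero n≡uRP^s+1 n≢0}}}}}}

<-monotone⇒injective : ∀ {r} {f : Fin r → ℕ} → (∀ i j → i F.< j → f i < f j) → ∀ {i j} → f i ≡ f j → i ≡ j
<-monotone⇒injective {f = f} mono {i} {j} fi≡fj with Finₚ.<-cmp i j
... | tri< i<j _ _ = ⊥-elim (<-irrefl fi≡fj (mono i j i<j))
... | tri≈ _ i≡j _ = i≡j
... | tri> _ _ j<i = ⊥-elim (<-irrefl (sym fi≡fj) (mono j i j<i))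

proposition3p4 : (r : ℕ) (p e : Fin r → ℕ) (a : Fin r) →
    (∀ i → Prime (p i)) →
    (∀ i j → i F.< j → p i < p j) →
    (∀ i → 1 ≤ e i) →
    3 ≤ r →
    2 ≤ e a →
    ((radQuot r p e a < 2 * φ (radQuot r p e a)) →
       ∀ s → 1 ≤ s → s < e a → cardZ r p e a s < cardZ r p e a (suc s))
    × ((2 * φ (radQuot r p e a) < radQuot r p e a) →
       ∀ s → 1 ≤ s → s < e a → cardZ r p e a (suc s) < cardZ r p e a s)
proposition3p4 (suc r) p e a p-prime p-mono e≥1 _ _ = increasing , decreasing
  where
  open Factorisation r p e a p-prime (<-monotone⇒injective p-mono) e≥1
  increasing : R < 2 * φ R → ∀ s → 1 ≤ s → s < e a → Z s < Z (suc s)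
  increasing R<2φR s _ s<e =
    let d , d≢0 , balance = Z-step s<e in +-*-balance⇒< {Z s} {Z (suc s)} d {{d≢0}} balance R<2φR
  decreasing : 2 * φ R < R → ∀ s → 1 ≤ s → s < e a → Z (suc s) < Z s
  decreasing 2φR<R s _ s<e =
    let d , d≢0 , balance = Z-step s<e in +-*-balance⇒< {Z (suc s)} {Z s} d {{d≢0}} (sym balance) 2φR<R
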